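{- Let $(\vec G=(V,E),\sigma)$ be a best match graph and $\mathscr V$ a partition of $V$ with $|\mathscr V|\ge 2$ such that $c(\vec G,\mathscr V)=0$. Then the induced subgraph $(\vec G[V'],\sigma_{|V'})$ is a best match graph for every $V'\in\mathscr V$.
   Context: A digraph $\vec G=(V,E)$ has a finite vertex set and arc set $E\subseteq (V\times V)\setminus\{(v,v)\mid v\in V\}$; $\vec G[W]$ is the induced subgraph on $W$. All rooted trees are phylogenetic (every non-leaf vertex has at least two children); $L(T)$ is the leaf set, $\rho_T$ the root, $T(v)$ the subtree rooted at $v$, $\mathrm{child}_T(v)$ the children of $v$; $u\preceq_T v$ means $v$ lies on the path from $u$ to the root; $\mathrm{lca}_T$ is the last common ancestor. For a tree $T$ with leaf coloring $\sigma$, a leaf $y$ is a best match of a leaf $x$ if $\sigma(x)\ne\sigma(y)$ and $\mathrm{lca}_T(x,y)\preceq_T\mathrm{lca}_T(x,y')$ for all leaves $y'$ with $\sigma(y')=\sigma(y)$; the best match graph $\vec G(T,\sigma)$ has vertex set $L(T)$, coloring $\sigma$, and arcs $(x,y)$ whenever $y$ is a best match of $x$. A vertex-colored digraph is a best match graph (BMG) if it equals $\vec G(T,\sigma)$ for some leaf-colored tree. For a tree $T$ with $L(T)=V$, $U(\vec G,T)=E\triangle E(\vec G(T,\sigma))$. For a partition $\mathscr V$ of $V$ with $|\mathscr V|\ge 2$, $\mathscr T(\mathscr V)$ is the set of phylogenetic trees $T$ with $L(T)=V$ and $\{L(T(v))\mid v\in\mathrm{child}_T(\rho_T)\}=\mathscr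 V$, $U(\vec G,\mathscr V)=\bigcap_{T\in\mathscr T(\mathscr V)}U(\vec G,T)$, and $c(\vec G,\mathscr V)=|U(\vec G,\mathscr V)|$. -}

module Defs where

open import Data.Nat using (ℕ; suc; _≤_)
open import Data.Fin using (Fin)
open import Data.Empty using (⊥)
open import Data.Product using (Σ; ∃; _×_; proj₁)
open import Data.Sum using (_⊎_)
open import Relation.Nullary using (¬_)
open import Relation.Binary.PropositionalEquality using (_≡_)
open import Function.Bundles using (_⇔_)

-- Rooted phylogenetic trees with leaves labelled by elements of X.
-- Every inner vertex has at least two children (Fin (suc (suc k))).

data Tree (X : Set) : Set where
  leaf : X → Tree X
  node : {k : ℕ} → (Fin (suc (suc k)) → Tree X) → Tree X

-- Vertices of a tree, given by their path from the root.
data Pos {X : Set} : Tree X → Set where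
  here  : {t : Tree X} → Pos t
  there : {k : ℕ} {f : Fin (suc (suc k)) → Tree X}
          (i : Fin (suc (suc k))) → Pos (f i) → Pos (node f)

LeafAt : {X : Set} (t : Tree X) → Pos t → X → Set
LeafAt (leaf y) here x = y ≡ x
LeafAt (node f) here x = ⊥
LeafAt (node f) (there i p) x = LeafAt (f i) p x

data _⪯_ {X : Set} : {t : Tree X} → Pos t → Pos t → Set where
  ⪯-root  : {t : Tree X} {u : Pos t} → u ⪯ here
  ⪯-there : {k : ℕ} {f : Fin (suc (suc k)) → Tree X} {i : Fin (suc (suc k))}
            {u v : Pos (f i)} → u ⪯ v → there {f = f} i u ⪯ there i v

IsLCA : {X : Set} {t : Tree X} → Pos t → Pos t → Pos t → Set
IsLCA {t = t} a b w =
  a ⪯ w × b ⪯ w × ((w' : Pos t) → a ⪯ w' → b ⪯ w' → w ⪯ w')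

InLeaves : {X : Set} → Tree X → X → Set
InLeaves t x = Σ (Pos t) λ p → LeafAt t p x

-- L(T) = V : every element of V labels exactly one leaf
-- (all leaves carry labels in V by construction).
LeafSetIsAll : {V : Set} → Tree V → Set
LeafSetIsAll {V} t =
  (v : V) → Σ (Pos t) λ p → LeafAt t p v × ((q : Pos t) → LeafAt t q v → q ≡ p)

BestMatch : {V C : Set} → Tree V → (V → C) → V → V → Set
BestMatch {V} t σ x y =
  ¬ (σ x ≡ σ y) ×
  ((y' : V) → σ y' ≡ σ y →
   (px py py' w w' : Pos t) →
   LeafAt t px x → LeafAt t py y → LeafAt t py' y' →
   IsLCA px py w → IsLCA px py' w' → w ⪯ w')

Explains : {V C : Set} → (V → V → Set) → (V → C) → Tree V → Set
Explains {V} E σ t =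
  LeafSetIsAll t × ((x y : V) → E x y ⇔ BestMatch t σ x y)

IsBMG : {V C : Set} → (V → V → Set) → (V → C) → Set
IsBMG {V} E σ = Σ (Tree V) λ t → Explains E σ t

-- Partitions of Fin n into k nonempty blocks: part v = index of v's block.

IsPartition : {n k : ℕ} → (Fin n → Fin k) → Set
IsPartition {n} {k} part = (j : Fin k) → ∃ λ v → part v ≡ j

Block : {n k : ℕ} → (Fin n → Fin k) → Fin k → Set
Block {n} part j = Σ (Fin n) λ v → part v ≡ j

nChildren : {X : Set} → Tree X → ℕ
nChildren (leaf _) = 0
nChildren (node {k} f) = suc (suc k)

childAt : {X : Set} (t : Tree X) → Fin (nChildren t) → Tree X
childAt (node f) i = f i

-- {L(T(v)) | v ∈ child(ρ_T)} = 𝒱 (as sets of subsets of V)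
RootSplitIs : {n k : ℕ} → (Fin n → Fin k) → Tree (Fin n) → Set
RootSplitIs {n} {k} part t =
  ((i : Fin (nChildren t)) → ∃ λ (j : Fin k) →
      (v : Fin n) → InLeaves (childAt t i) v ⇔ (part v ≡ j)) ×
  ((j : Fin k) → ∃ λ (i : Fin (nChildren t)) →
      (v : Fin n) → InLeaves (childAt t i) v ⇔ (part v ≡ j))

InTV : {n k : ℕ} → (Fin n → Fin k) → Tree (Fin n) → Set
InTV part t = LeafSetIsAll t × RootSplitIs part t

InU : {V C : Set} → (V → V → Set) → (V → C) → Tree V → V → V → Set
InU E σ t x y = (E x y × ¬ BestMatch t σ x y) ⊎ (¬ E x y × BestMatch t σ x y)

InUV : {n k : ℕ} {C : Set} → (Fin n → Fin n → Set) → (Fin n → C) →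
       (Fin n → Fin k) → Fin n → Fin n → Set
InUV E σ part x y = (t : Tree _) → InTV part t → InU E σ t x y

CostZero : {n k : ℕ} {C : Set} → (Fin n → Fin n → Set) → (Fin n → C) →
           (Fin n → Fin k) → Set
CostZero E σ part = (x y : _) → ¬ InUV E σ part x y

inducedE : {n k : ℕ} (E : Fin n → Fin n → Set) (part : Fin n → Fin k) (j : Fin k) →
           Block part j → Block part j → Set
inducedE E part j a b = E (proj₁ a) (proj₁ b)

inducedσ : {n k : ℕ} {C : Set} (σ : Fin n → C) (part : Fin n → Fin k) (j : Fin k) →
           Block part j → C
inducedσ σ part j a = σ (proj₁ a)

-- A tree T explaining G restricts to a tree T|V' on each block V', and y is a
-- best match of x in T|V' iff every cluster of T|V' containing x and a leaf of
-- colour σ y also contains y.  Since the clusters of T|V' are exactly the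
-- traces on V' of the clusters of T, every best match in T between vertices of
-- V' survives in T|V'.  Conversely, let y be a best match of x in T|V' and let
-- z be a best match of x in T of the colour of y.  If z were outside V', then
-- in every tree of 𝒯(𝒱) the root child with leaf set V' would contain x and y
-- but not z, so (x, z) would lie in U(G, 𝒱); as c(G, 𝒱) = 0, z ∈ V'.  Hence
-- every cluster of T containing x contains z, its trace contains y, and y is a
-- best match of x in T as well.

module Submission where

open import Defs
open import Axiom.UniquenessOfIdentityProofs using (module Decidable⇒UIP)
open import Data.Empty using (⊥-elim)
open import Data.Fin using (Fin; zero; suc)
open import Data.Fin.Properties using (_≟_; any?; suc-injective)
open import Data.Maybe using (Maybe; just; nothing)
open import Data.Nat using (ℕ; zero; suc; _≤_)
open import Data.Product using (Σ; ∃; _×_; _,_; proj₁; proj₂; map₂)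
open import Data.Sum using (inj₁)
open import Function using (_∘_)
open import Function.Bundles using (_⇔_; mk⇔; Equivalence)
open import Function.Definitions using (Injective)
import Function.Properties.Equivalence as ⇔
open import Relation.Binary.Definitions using (DecidableEquality)
open import Relation.Binary.PropositionalEquality using (_≡_; refl; sym; trans; subst; cong)
open import Relation.Nullary using (¬_; Dec; yes; no)
open import Relation.Nullary.Decidable using (decidable-stable; ¬¬-excluded-middle)
import Relation.Nullary.Decidable as Dec
open import Relation.Nullary.Negation using (¬¬-map)
open import Relation.Unary using (Decidable; Irrelevant)

open Equivalence using (to; from)

private
  variable
    X Y C : Set

⪯-trans : {t : Tree X} {u v w : Pos t} → u ⪯ v → v ⪯ w → u ⪯ w
⪯-trans _ ⪯-root = ⪯-root
⪯-trans (⪯-there p) (⪯-there q) = ⪯-there (⪯-trans p q)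

there-injectiveˡ : {k : ℕ} {f : Fin (suc (suc k)) → Tree X} {i i′ : Fin (suc (suc k))}
                   {p : Pos (f i)} {q : Pos (f i′)} → there {f = f} i p ≡ there i′ q → i ≡ i′
there-injectiveˡ refl = refl

there-injective : {k : ℕ} {f : Fin (suc (suc k)) → Tree X} {i : Fin (suc (suc k))}
                  {p q : Pos (f i)} → there {f = f} i p ≡ there i q → p ≡ q
there-injective refl = refl

InCluster : (t : Tree X) → Pos t → X → Set
InCluster t v a = Σ (Pos t) λ q → LeafAt t q a × q ⪯ v

InCluster-mono : {t : Tree X} {u w : Pos t} {a : X} → u ⪯ w → InCluster t u a → InCluster t w a
InCluster-mono u⪯w (q , lq , q⪯u) = q , lq , ⪯-trans q⪯u u⪯w

InCluster⇒InLeaves : {t : Tree X} {v : Pos t} {a : X} → InCluster t v a → InLeaves t a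
InCluster⇒InLeaves (q , lq , _) = q , lq

InCluster-here : {t : Tree X} {a : X} → InCluster t here a ⇔ InLeaves t a
InCluster-here = mk⇔ InCluster⇒InLeaves λ (q , lq) → q , lq , ⪯-root

InCluster-there : {k : ℕ} {f : Fin (suc (suc k)) → Tree X} {i : Fin (suc (suc k))}
                  {v : Pos (f i)} {a : X} → InCluster (node f) (there i v) a ⇔ InCluster (f i) v a
InCluster-there = mk⇔ (λ { (there _ q , lq , ⪯-there q⪯v) → q , lq , q⪯v })
                      (λ (q , lq , q⪯v) → there _ q , lq , ⪯-there q⪯v)

InCluster-child : {k : ℕ} {f : Fin (suc (suc k)) → Tree X} {i : Fin (suc (suc k))} {a : X} →
                  InCluster (node f) (there i here) a ⇔ InLeaves (f i) a
InCluster-child = ⇔.trans InCluster-there InCluster-here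

InLeaves-node : {k : ℕ} {f : Fin (suc (suc k)) → Tree X} {a : X} →
                InLeaves (node f) a ⇔ ∃ λ i → InLeaves (f i) a
InLeaves-node = mk⇔ (λ { (there i q , lq) → i , q , lq }) (λ (i , q , lq) → there i q , lq)

module _ (_≟ˣ_ : DecidableEquality X) where

  InLeaves? : (t : Tree X) (a : X) → Dec (InLeaves t a)
  InLeaves? (leaf b) a = Dec.map (mk⇔ (here ,_) λ { (here , e) → e }) (b ≟ˣ a)
  InLeaves? (node f) a = Dec.map (⇔.sym InLeaves-node) (any? λ i → InLeaves? (f i) a)

  InCluster? : (t : Tree X) (v : Pos t) (a : X) → Dec (InCluster t v a)
  InCluster? t here a = Dec.map (⇔.sym InCluster-here) (InLeaves? t a)
  InCluster? (node f) (there i v) a = Dec.map (⇔.sym InCluster-there) (InCluster? (f i) v a)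

LeafSetIsAll⇒InLeaves : {t : Tree X} → LeafSetIsAll t → (a : X) → InLeaves t a
LeafSetIsAll⇒InLeaves all a = proj₁ (all a) , proj₁ (proj₂ (all a))

UniqueLeaves : Tree X → Set
UniqueLeaves {X} t = (a : X) (p q : Pos t) → LeafAt t p a → LeafAt t q a → p ≡ q

LeafSetIsAll⇒UniqueLeaves : {t : Tree X} → LeafSetIsAll t → UniqueLeaves t
LeafSetIsAll⇒UniqueLeaves all a p q lp lq =
  trans (proj₂ (proj₂ (all a)) p lp) (sym (proj₂ (proj₂ (all a)) q lq))

UniqueLeaves-child : {k : ℕ} {f : Fin (suc (suc k)) → Tree X} →
                     UniqueLeaves (node f) → (i : Fin (suc (suc k))) → UniqueLeaves (f i)
UniqueLeaves-child U i a p q lp lq = there-injective (U a (there i p) (there i q) lp lq)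

InCluster⇒⪯ : {t : Tree X} {p v : Pos t} {a : X} →
              UniqueLeaves t → LeafAt t p a → InCluster t v a → p ⪯ v
InCluster⇒⪯ {v = v} U lp (q , lq , q⪯v) = subst (_⪯ v) (U _ q _ lq lp) q⪯v

IsLCA-there : {k : ℕ} {f : Fin (suc (suc k)) → Tree X} (i : Fin (suc (suc k))) {p q w : Pos (f i)} →
              IsLCA p q w → IsLCA {t = node f} (there i p) (there i q) (there i w)
IsLCA-there i (p⪯w , q⪯w , least) = ⪯-there p⪯w , ⪯-there q⪯w , λ
  { here _ _ → ⪯-root
  ; (there _ w′) (⪯-there p⪯w′) (⪯-there q⪯w′) → ⪯-there (least w′ p⪯w′ q⪯w′) }

IsLCA-apart : {k : ℕ} {f : Fin (suc (suc k)) → Tree X} {i i′ : Fin (suc (suc k))}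
              (p : Pos (f i)) (q : Pos (f i′)) → ¬ i ≡ i′ →
              IsLCA {t = node f} (there i p) (there i′ q) here
IsLCA-apart p q i≢i′ = ⪯-root , ⪯-root , λ
  { here _ _ → ⪯-root
  ; (there _ _) (⪯-there _) (⪯-there _) → ⊥-elim (i≢i′ refl) }

lca : (t : Tree X) (p q : Pos t) → ∃ (IsLCA p q)
lca t here q = here , ⪯-root , ⪯-root , λ _ here⪯w _ → here⪯w
lca t (there i p) here = here , ⪯-root , ⪯-root , λ _ _ here⪯w → here⪯w
lca (node f) (there i p) (there i′ q) with i ≟ i′
... | yes refl = let (w , w-lca) = lca (f i) p q in there i w , IsLCA-there i w-lca
... | no i≢i′ = here , IsLCA-apart p q i≢i′

LeastAbove : (t : Tree X) → (Pos t → Set) → Pos t → Pos t → Set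
LeastAbove t Q p v = p ⪯ v × Q v × ((w : Pos t) → p ⪯ w → Q w → v ⪯ w)

-- Only up to double negation, since Q need not be decidable.
least-ancestor : {t : Tree X} (Q : Pos t → Set) → (∀ {u w} → u ⪯ w → Q u → Q w) → Q here →
                 (p : Pos t) → ¬ ¬ ∃ (LeastAbove t Q p)
least-ancestor Q mono Q-here here ¬least = ¬least (here , ⪯-root , Q-here , λ _ p⪯w _ → p⪯w)
least-ancestor {t = node f} Q mono Q-here (there i p) ¬least =
  ¬¬-excluded-middle {A = ∃ λ q → p ⪯ q × Q (there i q)} λ
  { (yes (q , p⪯q , Q-q)) →
      least-ancestor (Q ∘ there i) (λ u⪯w → mono (⪯-there u⪯w)) (mono (⪯-there ⪯-root) Q-q) p
        λ (v , p⪯v , Q-v , least) → ¬least (there i v , ⪯-there p⪯v , Q-v , λ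
          { here _ _ → ⪯-root
          ; (there _ w) (⪯-there p⪯w) Q-w → ⪯-there (least w p⪯w Q-w) })
  ; (no ∄q) → ¬least (here , ⪯-root , Q-here , λ
          { here _ _ → ⪯-root
          ; (there _ w) (⪯-there p⪯w) Q-w → ⊥-elim (∄q (w , p⪯w , Q-w)) }) }

ClusterBestMatch : Tree X → (X → C) → X → X → Set
ClusterBestMatch {X} t σ x y = ¬ σ x ≡ σ y ×
  ((y′ : X) → σ y′ ≡ σ y → (v : Pos t) → InCluster t v x → InCluster t v y′ → InCluster t v y)

BestMatch⇒ClusterBestMatch : {t : Tree X} {σ : X → C} {x y : X} →
                             InLeaves t y → BestMatch t σ x y → ClusterBestMatch t σ x y
BestMatch⇒ClusterBestMatch {t = t} (py , ly) (σx≢σy , closer) =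
  σx≢σy , λ y′ c v (px , lx , x⪯v) (py′ , ly′ , y′⪯v) →
    let (w , w-lca) = lca t px py
        (w′ , w′-lca) = lca t px py′
        y⪯w = proj₁ (proj₂ w-lca)
        w⪯w′ = closer y′ c px py py′ w w′ lx ly ly′ w-lca w′-lca
        w′⪯v = proj₂ (proj₂ w′-lca) v x⪯v y′⪯v
    in py , ly , ⪯-trans y⪯w (⪯-trans w⪯w′ w′⪯v)

ClusterBestMatch⇒BestMatch : {t : Tree X} {σ : X → C} {x y : X} →
                             UniqueLeaves t → ClusterBestMatch t σ x y → BestMatch t σ x y
ClusterBestMatch⇒BestMatch U (σx≢σy , closer) =
  σx≢σy , λ y′ c px py py′ w w′ lx ly ly′ (_ , _ , w-least) (x⪯w′ , y′⪯w′ , _) →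
    let y∈w′ = closer y′ c w′ (px , lx , x⪯w′) (py′ , ly′ , y′⪯w′)
    in w-least w′ x⪯w′ (InCluster⇒⪯ U ly y∈w′)

ClusterBestMatch-stable : DecidableEquality X → {t : Tree X} {σ : X → C} {x y : X} →
                          ¬ σ x ≡ σ y → ¬ ¬ ClusterBestMatch t σ x y → ClusterBestMatch t σ x y
ClusterBestMatch-stable _≟ˣ_ {t} {y = y} σx≢σy ¬¬bm = σx≢σy , λ y′ c v x∈v y′∈v →
  decidable-stable (InCluster? _≟ˣ_ t v y) (¬¬-map (λ bm → proj₂ bm y′ c v x∈v y′∈v) ¬¬bm)

-- The leaf of colour σ y below the least ancestor of x with such a leaf.
closest-exists : {t : Tree X} {σ : X → C} {x y : X} → UniqueLeaves t →
                 InLeaves t x → InLeaves t y → ¬ σ x ≡ σ y →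
                 ¬ ¬ ∃ λ z → σ z ≡ σ y × ClusterBestMatch t σ x z
closest-exists {t = t} {σ} {y = y} U (px , lx) (py , ly) σx≢σy =
  ¬¬-map closest (least-ancestor Q Q-mono (y , refl , py , ly , ⪯-root) px)
  where
  Q : Pos t → Set
  Q u = ∃ λ z → σ z ≡ σ y × InCluster t u z

  Q-mono : ∀ {u w} → u ⪯ w → Q u → Q w
  Q-mono u⪯w (z , c , z∈u) = z , c , InCluster-mono u⪯w z∈u

  closest : ∃ (LeastAbove t Q px) → ∃ λ z → σ z ≡ σ y × ClusterBestMatch t σ _ z
  closest (v , _ , (z , c , z∈v) , least) = z , c , (λ e → σx≢σy (trans e c)) ,
    λ y′ c′ u x∈u y′∈u →
      InCluster-mono (least u (InCluster⇒⪯ U lx x∈u) (y′ , trans c′ c , y′∈u)) z∈v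

IsTrace : (Y → X) → (s : Tree Y) → Pos s → (t : Tree X) → Pos t → Set
IsTrace {Y} ι s v′ t v = (b : Y) → InCluster s v′ b ⇔ InCluster t v (ι b)

-- s is t with the leaves outside the image of ι removed: the clusters of s are
-- exactly the nonempty traces of the clusters of t.
record Restricts (ι : Y → X) (s : Tree Y) (t : Tree X) : Set where
  field
    leaves              : (b : Y) → InLeaves s b ⇔ InLeaves t (ι b)
    clusters-are-traces : (v′ : Pos s) → ∃ (IsTrace ι s v′ t)
    traces-are-clusters : (v : Pos t) (x : Y) → InCluster t v (ι x) → ∃ λ v′ → IsTrace ι s v′ t v
    unique-leaves       : UniqueLeaves t → UniqueLeaves s

open Restricts

IsRestriction : (Y → X) → Tree X → Maybe (Tree Y) → Set
IsRestriction {Y} ι t nothing = (b : Y) → ¬ InLeaves t (ι b)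
IsRestriction ι t (just s) = Restricts ι s t

IsRestriction-nonempty : {ι : Y → X} {t : Tree X} {r : Maybe (Tree Y)} {b : Y} →
                         IsRestriction ι t r → InLeaves t (ι b) → ∃ λ s → r ≡ just s
IsRestriction-nonempty {r = nothing} {b} R b∈t = ⊥-elim (R b b∈t)
IsRestriction-nonempty {r = just s} R _ = s , refl

LeafSetIsAll-restrict : {ι : Y → X} {s : Tree Y} {t : Tree X} →
                        Restricts ι s t → LeafSetIsAll t → LeafSetIsAll s
LeafSetIsAll-restrict {ι = ι} R all b =
  let (p , lp) = from (leaves R b) (LeafSetIsAll⇒InLeaves all (ι b))
  in p , lp , λ q lq → unique-leaves R (LeafSetIsAll⇒UniqueLeaves all) b q p lq lp

IsTrace-root : {ι : Y → X} {s : Tree Y} {t : Tree X} →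
               ((b : Y) → InLeaves s b ⇔ InLeaves t (ι b)) → IsTrace ι s here t here
IsTrace-root same-leaves b =
  ⇔.trans InCluster-here (⇔.trans (same-leaves b) (⇔.sym InCluster-here))

IsTrace-thereˡ : {ι : Y → X} {c : ℕ} {T : Fin (suc (suc c)) → Tree Y} {k : Fin (suc (suc c))}
                 {v′ : Pos (T k)} {t : Tree X} {v : Pos t} →
                 IsTrace ι (T k) v′ t v → IsTrace ι (node T) (there k v′) t v
IsTrace-thereˡ trace b = ⇔.trans InCluster-there (trace b)

IsTrace-thereʳ : {ι : Y → X} {s : Tree Y} {v′ : Pos s} {m : ℕ} {f : Fin (suc (suc m)) → Tree X}
                 {i : Fin (suc (suc m))} {v : Pos (f i)} →
                 IsTrace ι s v′ (f i) v → IsTrace ι s v′ (node f) (there i v)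
IsTrace-thereʳ trace b = ⇔.trans (trace b) (⇔.sym InCluster-there)

restricts-leaf : {ι : Y → X} → Injective _≡_ _≡_ ι → (b : Y) → Restricts ι (leaf b) (leaf (ι b))
restricts-leaf {Y = Y} {ι = ι} ι-injective b = record
  { leaves = leaves′
  ; clusters-are-traces = λ { here → here , IsTrace-root leaves′ }
  ; traces-are-clusters = λ { here _ _ → here , IsTrace-root leaves′ }
  ; unique-leaves = λ { _ _ here here _ _ → refl } }
  where
  leaves′ : (b′ : Y) → InLeaves (leaf b) b′ ⇔ InLeaves (leaf (ι b)) (ι b′)
  leaves′ b′ = mk⇔ (λ { (here , e) → here , cong ι e }) (λ { (here , e) → here , ι-injective e })

Covers : {M c : ℕ} → (Y → X) → (Fin M → Tree X) → (Fin c → Fin M) → Set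
Covers {Y} ι f I = (b : Y) (i : Fin _) → InLeaves (f i) (ι b) → ∃ λ k → I k ≡ i

restricts-onlyChild : {ι : Y → X} {s : Tree Y} {m : ℕ} {f : Fin (suc (suc m)) → Tree X}
                      {i₀ : Fin (suc (suc m))} → Restricts ι s (f i₀) →
                      ((b : Y) (i : Fin (suc (suc m))) → InLeaves (f i) (ι b) → i ≡ i₀) →
                      Restricts ι s (node f)
restricts-onlyChild {Y = Y} {ι = ι} {s = s} {m = m} {f = f} {i₀ = i₀} R only = record
  { leaves = leaves′
  ; clusters-are-traces = λ v′ → let (v , trace) = clusters-are-traces R v′
                                  in there i₀ v , IsTrace-thereʳ trace
  ; traces-are-clusters = traces
  ; unique-leaves = λ U → unique-leaves R (UniqueLeaves-child U i₀) }
  where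
  leaves′ : (b : Y) → InLeaves s b ⇔ InLeaves (node f) (ι b)
  leaves′ b = mk⇔ (λ b∈s → from InLeaves-node (i₀ , to (leaves R b) b∈s))
                  (λ b∈t → let (i , b∈fi) = to InLeaves-node b∈t
                           in from (leaves R b) (subst (λ i → InLeaves (f i) (ι b)) (only b i b∈fi) b∈fi))

  traces-child : (i : Fin (suc (suc m))) (v : Pos (f i)) (x : Y) → InCluster (f i) v (ι x) → i ≡ i₀ →
                 ∃ λ v′ → IsTrace ι s v′ (node f) (there i v)
  traces-child _ v x x∈v refl = map₂ IsTrace-thereʳ (traces-are-clusters R v x x∈v)

  traces : (v : Pos (node f)) (x : Y) → InCluster (node f) v (ι x) →
           ∃ λ v′ → IsTrace ι s v′ (node f) v
  traces here _ _ = here , IsTrace-root leaves′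
  traces (there i v) x x∈v = let x∈fi = to InCluster-there x∈v
                             in traces-child i v x x∈fi (only x i (InCluster⇒InLeaves x∈fi))

restricts-node : {ι : Y → X} {c m : ℕ} {f : Fin (suc (suc m)) → Tree X}
                 (I : Fin (suc (suc c)) → Fin (suc (suc m))) → Injective _≡_ _≡_ I →
                 (T : Fin (suc (suc c)) → Tree Y) →
                 ((k : Fin (suc (suc c))) → Restricts ι (T k) (f (I k))) →
                 Covers ι f I → Restricts ι (node T) (node f)
restricts-node {Y = Y} {ι = ι} {c = c} {m = m} {f = f} I I-injective T R covers = record
  { leaves = leaves′
  ; clusters-are-traces = λ
      { here → here , IsTrace-root leaves′
      ; (there k v′) → let (v , trace) = clusters-are-traces (R k) v′
                       in there (I k) v , IsTrace-thereˡ (IsTrace-thereʳ trace) }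
  ; traces-are-clusters = traces
  ; unique-leaves = unique }
  where
  leaves′ : (b : Y) → InLeaves (node T) b ⇔ InLeaves (node f) (ι b)
  leaves′ b = mk⇔
    (λ b∈s → let (k , b∈Tk) = to InLeaves-node b∈s
             in from InLeaves-node (I k , to (leaves (R k) b) b∈Tk))
    (λ b∈t → let (i , b∈fi) = to InLeaves-node b∈t ; (k , Ik≡i) = covers b i b∈fi
             in from InLeaves-node (k , from (leaves (R k) b)
                                          (subst (λ i → InLeaves (f i) (ι b)) (sym Ik≡i) b∈fi)))

  traces-child : (k : Fin (suc (suc c))) (i : Fin (suc (suc m))) (v : Pos (f i)) (x : Y) →
                 InCluster (f i) v (ι x) → I k ≡ i →
                 ∃ λ v′ → IsTrace ι (node T) v′ (node f) (there i v)
  traces-child k _ v x x∈v refl =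
    let (v′ , trace) = traces-are-clusters (R k) v x x∈v
    in there k v′ , IsTrace-thereˡ (IsTrace-thereʳ trace)

  traces : (v : Pos (node f)) (x : Y) → InCluster (node f) v (ι x) →
           ∃ λ v′ → IsTrace ι (node T) v′ (node f) v
  traces here _ _ = here , IsTrace-root leaves′
  traces (there i v) x x∈v =
    let x∈fi = to InCluster-there x∈v
        (k , Ik≡i) = covers x i (InCluster⇒InLeaves x∈fi)
    in traces-child k i v x x∈fi Ik≡i

  unique : UniqueLeaves (node f) → UniqueLeaves (node T)
  unique U b (there k p) (there k′ q) lp lq with I-injective (there-injectiveˡ
      (U (ι b) (there (I k) _) (there (I k′) _)
         (proj₂ (to (leaves (R k) b) (p , lp))) (proj₂ (to (leaves (R k′) b) (q , lq)))))
  ... | refl = cong (there k) (unique-leaves (R k) (UniqueLeaves-child U (I k)) b p q lp lq)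

record Selection {M : ℕ} (S : Fin M → Set) : Set where
  field
    count           : ℕ
    index           : Fin count → Fin M
    index-injective : Injective _≡_ _≡_ index
    index-sound     : (k : Fin count) → S (index k)
    index-complete  : (i : Fin M) → S i → ∃ λ k → index k ≡ i

open Selection

selection-keep : {M : ℕ} {S : Fin (suc M) → Set} → S zero → Selection (S ∘ suc) → Selection S
selection-keep s₀ sel .count = suc (sel .count)
selection-keep s₀ sel .index zero = zero
selection-keep s₀ sel .index (suc k) = suc (sel .index k)
selection-keep s₀ sel .index-injective {zero} {zero} _ = refl
selection-keep s₀ sel .index-injective {suc k} {suc k′} e = cong suc (sel .index-injective (suc-injective e))
selection-keep s₀ sel .index-sound zero = s₀
selection-keep s₀ sel .index-sound (suc k) = sel .index-sound k
selection-keep s₀ sel .index-complete zero _ = zero , refl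
selection-keep s₀ sel .index-complete (suc i) s = let (k , e) = sel .index-complete i s in suc k , cong suc e

selection-skip : {M : ℕ} {S : Fin (suc M) → Set} → ¬ S zero → Selection (S ∘ suc) → Selection S
selection-skip ¬s₀ sel .count = sel .count
selection-skip ¬s₀ sel .index k = suc (sel .index k)
selection-skip ¬s₀ sel .index-injective e = sel .index-injective (suc-injective e)
selection-skip ¬s₀ sel .index-sound = sel .index-sound
selection-skip ¬s₀ sel .index-complete zero s = ⊥-elim (¬s₀ s)
selection-skip ¬s₀ sel .index-complete (suc i) s = map₂ (cong suc) (sel .index-complete i s)

select : {M : ℕ} {S : Fin M → Set} → Decidable S → Selection S
select {zero} S? .count = zero
select {zero} S? .index ()
select {zero} S? .index-injective {()}
select {zero} S? .index-sound ()
select {zero} S? .index-complete ()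
select {suc M} S? with S? zero
... | yes s₀ = selection-keep s₀ (select (S? ∘ suc))
... | no ¬s₀ = selection-skip ¬s₀ (select (S? ∘ suc))

just? : (r : Maybe X) → Dec (∃ λ x → r ≡ just x)
just? nothing = no λ ()
just? (just x) = yes (x , refl)

justs : {M : ℕ} (g : Fin M → Maybe X) → Selection (λ i → ∃ λ x → g i ≡ just x)
justs g = select (just? ∘ g)

-- A node with fewer than two children is not phylogenetic; it collapses.
gather : (c : ℕ) → (Fin c → Tree X) → Maybe (Tree X)
gather zero _ = nothing
gather (suc zero) T = just (T zero)
gather (suc (suc c)) T = just (node T)

gatherJusts : {M : ℕ} → (Fin M → Maybe (Tree X)) → Maybe (Tree X)
gatherJusts g = gather (justs g .count) (proj₁ ∘ justs g .index-sound)

gather-isRestriction : {ι : Y → X} {m : ℕ} {f : Fin (suc (suc m)) → Tree X} (c : ℕ)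
                       (I : Fin c → Fin (suc (suc m))) → Injective _≡_ _≡_ I →
                       (T : Fin c → Tree Y) → ((k : Fin c) → Restricts ι (T k) (f (I k))) →
                       Covers ι f I → IsRestriction ι (node f) (gather c T)
gather-isRestriction zero I _ T R covers b b∈t
  with () ← proj₁ (covers b _ (proj₂ (to InLeaves-node b∈t)))
gather-isRestriction (suc zero) I _ T R covers =
  restricts-onlyChild (R zero) λ b i b∈fi → only (covers b i b∈fi)
  where
  only : {i : Fin _} → ∃ (λ k → I k ≡ i) → i ≡ I zero
  only (zero , e) = sym e
gather-isRestriction (suc (suc c)) I I-injective T R covers = restricts-node I I-injective T R covers

gatherJusts-isRestriction : {ι : Y → X} {m : ℕ} {f : Fin (suc (suc m)) → Tree X}
                            {g : Fin (suc (suc m)) → Maybe (Tree Y)} →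
                            ((i : Fin (suc (suc m))) → IsRestriction ι (f i) (g i)) →
                            IsRestriction ι (node f) (gatherJusts g)
gatherJusts-isRestriction {ι = ι} {f = f} {g} R =
  gather-isRestriction (sel .count) (sel .index) (sel .index-injective) (proj₁ ∘ sel .index-sound)
    (λ k → subst (IsRestriction ι (f (sel .index k))) (proj₂ (sel .index-sound k)) (R (sel .index k)))
    (λ b i b∈fi → sel .index-complete i (IsRestriction-nonempty (R i) b∈fi))
  where
  sel = justs g

module Restriction {P : X → Set} (P? : Decidable P) (P-irrelevant : Irrelevant P) where

  proj₁-injective : Injective _≡_ _≡_ (proj₁ {B = P})
  proj₁-injective {x , p} {.x , q} refl = cong (x ,_) (P-irrelevant p q)

  restrict : Tree X → Maybe (Tree (Σ X P))
  restrict (leaf a) with P? a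
  ... | yes p = just (leaf (a , p))
  ... | no _ = nothing
  restrict (node f) = gatherJusts (restrict ∘ f)

  restrict-isRestriction : (t : Tree X) → IsRestriction proj₁ t (restrict t)
  restrict-isRestriction (leaf a) with P? a
  ... | yes p = restricts-leaf proj₁-injective (a , p)
  ... | no ¬p = λ { (b , p) (here , e) → ¬p (subst P (sym e) p) }
  restrict-isRestriction (node f) = gatherJusts-isRestriction (restrict-isRestriction ∘ f)

  restriction : (t : Tree X) (b : Σ X P) → InLeaves t (proj₁ b) → ∃ λ s → Restricts proj₁ s t
  restriction t b b∈t =
    let (s , e) = IsRestriction-nonempty {b = b} (restrict-isRestriction t) b∈t
    in s , subst (IsRestriction proj₁ t) e (restrict-isRestriction t)

ClusterBestMatch-restrict : {ι : Y → X} {s : Tree Y} {t : Tree X} {σ : X → C} {x y : Y} →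
                            Restricts ι s t → ClusterBestMatch t σ (ι x) (ι y) →
                            ClusterBestMatch s (σ ∘ ι) x y
ClusterBestMatch-restrict {ι = ι} {x = x} {y} R (σx≢σy , closer) =
  σx≢σy , λ y′ c v′ x∈v′ y′∈v′ →
  let (v , trace) = clusters-are-traces R v′
  in from (trace y) (closer (ι y′) c v (to (trace x) x∈v′) (to (trace y′) y′∈v′))

ClusterBestMatch-extend : {ι : Y → X} {s : Tree Y} {t : Tree X} {σ : X → C} {x y z : Y} →
                          Restricts ι s t → ClusterBestMatch s (σ ∘ ι) x y →
                          ClusterBestMatch t σ (ι x) (ι z) → σ (ι z) ≡ σ (ι y) →
                          ClusterBestMatch t σ (ι x) (ι y)
ClusterBestMatch-extend {x = x} {y} {z} R (σx≢σy , closerˢ) (_ , closerᵗ) σz≡σy =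
  σx≢σy , λ y′ c v x∈v y′∈v →
    let (v′ , trace) = traces-are-clusters R v x x∈v
        z∈v = closerᵗ y′ (trans c (sym σz≡σy)) v x∈v y′∈v
    in to (trace y) (closerˢ z σz≡σy v′ (from (trace x) x∈v) (from (trace z) z∈v))

BestMatchClosed : (X → X → Set) → (X → C) → (X → Set) → Set
BestMatchClosed {X} E σ P = {x y z : X} → P x → P y → σ y ≡ σ z → E x z → P z

Explains-restrict : DecidableEquality X → {P : X → Set} {E : X → X → Set} {σ : X → C}
                    {t : Tree X} {s : Tree (Σ X P)} →
                    Explains E σ t → Restricts proj₁ s t → BestMatchClosed E σ P →
                    Explains (λ a b → E (proj₁ a) (proj₁ b)) (σ ∘ proj₁) s
Explains-restrict {X = X} _≟ˣ_ {P} {E} {σ} {t} {s} (all , explains) R closed =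
  allˢ , λ x y → mk⇔ (restricted x y) (extended x y)
  where
  U = LeafSetIsAll⇒UniqueLeaves all
  allˢ = LeafSetIsAll-restrict R all
  Uˢ = LeafSetIsAll⇒UniqueLeaves allˢ

  restricted : (x y : Σ X P) → E (proj₁ x) (proj₁ y) → BestMatch s (σ ∘ proj₁) x y
  restricted x y e = ClusterBestMatch⇒BestMatch Uˢ (ClusterBestMatch-restrict R
    (BestMatch⇒ClusterBestMatch (LeafSetIsAll⇒InLeaves all _) (to (explains _ _) e)))

  extended : (x y : Σ X P) → BestMatch s (σ ∘ proj₁) x y → E (proj₁ x) (proj₁ y)
  extended (x , Px) (y , Py) bm = from (explains x y) (ClusterBestMatch⇒BestMatch U
    (ClusterBestMatch-stable _≟ˣ_ σx≢σy (¬¬-map via-closest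
      (closest-exists U (LeafSetIsAll⇒InLeaves all x) (LeafSetIsAll⇒InLeaves all y) σx≢σy))))
    where
    bmˢ = BestMatch⇒ClusterBestMatch (LeafSetIsAll⇒InLeaves allˢ _) bm
    σx≢σy = proj₁ bmˢ

    via-closest : (∃ λ z → σ z ≡ σ y × ClusterBestMatch t σ x z) → ClusterBestMatch t σ x y
    via-closest (z , σz≡σy , bmᵗ) =
      let Pz = closed Px Py (sym σz≡σy) (from (explains x z) (ClusterBestMatch⇒BestMatch U bmᵗ))
      in ClusterBestMatch-extend {z = z , Pz} R bmˢ bmᵗ σz≡σy

bestMatch-inRootBlock : {n k : ℕ} {σ : Fin n → C} {part : Fin n → Fin k} {j : Fin k}
                        {t : Tree (Fin n)} {x y z : Fin n} → InTV part t →
                        part x ≡ j → part y ≡ j → σ y ≡ σ z → BestMatch t σ x z → part z ≡ j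
bestMatch-inRootBlock {j = j} {leaf _} (_ , _ , root-blocks) with () ← proj₁ (root-blocks j)
bestMatch-inRootBlock {part = part} {j} {node f} {x} {y} {z} (all , _ , root-blocks) px py c bm =
  let (i , child≡block) = root-blocks j
      in-child : (a : Fin _) → part a ≡ j → InCluster (node f) (there i here) a
      in-child a pa = from InCluster-child (from (child≡block a) pa)
      (_ , closer) = BestMatch⇒ClusterBestMatch (LeafSetIsAll⇒InLeaves all z) bm
  in to (child≡block z) (to InCluster-child (closer y c (there i here) (in-child x px) (in-child y py)))

costZero⇒bestMatchClosed : {n k : ℕ} {E : Fin n → Fin n → Set} {σ : Fin n → C}
                           {part : Fin n → Fin k} → CostZero E σ part →
                           (j : Fin k) → BestMatchClosed E σ (λ v → part v ≡ j)
costZero⇒bestMatchClosed {part = part} cost j {x} {y} {z} px py c e =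
  decidable-stable (part z ≟ j) λ pz≢j →
    cost x z λ t t∈𝒯 → inj₁ (e , λ bm → pz≢j (bestMatch-inRootBlock t∈𝒯 px py c bm))

lemma5 : {C : Set} (n k : ℕ) (E : Fin n → Fin n → Set) (σ : Fin n → C) →
         ((v : Fin n) → ¬ E v v) →
         IsBMG E σ →
         (part : Fin n → Fin k) → IsPartition part → 2 ≤ k →
         CostZero E σ part →
         (j : Fin k) → IsBMG (inducedE E part j) (inducedσ σ part j)
lemma5 n k E σ _ (T , explains) part partition _ cost j =
  let (v , v∈j) = partition j
      (s , T|j) = restriction T (v , v∈j) (LeafSetIsAll⇒InLeaves (proj₁ explains) v)
  in s , Explains-restrict _≟_ explains T|j (costZero⇒bestMatchClosed cost j)
  where
  open Restriction (λ v → part v ≟ j) (Decidable⇒UIP.≡-irrelevant _≟_)
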